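{- Let $n\ge3$ and let $P$ be the $n$-dimensional hypercube, the convex hull of all vectors $(\pm1,\pm1,\ldots,\pm1)\in\mathbb{R}^n$. Then its face lattice $L(P)$ is not isomorphic to the core of any upho lattice.
   Context: The face lattice of a polytope is the poset of its faces (including the empty face and the polytope itself) ordered by inclusion; it is a finite graded lattice with rank of a face $F$ equal to $\dim F+1$. A poset $\mathcal{P}$ is finite type $\mathbb{N}$-graded if it has a minimum $\hat0$, a rank function $\rho$ with $\rho(\hat0)=0$ such that every maximal chain has the form $\hat0=x_0\lessdot x_1\lessdot\cdots$ with $\rho(x_i)=i$, and finitely many elements of each rank. An upho lattice is a finite type $\mathbb{N}$-graded lattice $\mathcal{L}$ with at least two elements such that for every $p\in\mathcal{L}$ the principal filter $\{q\ge p\}$ is isomorphic to $\mathcal{L}$. Its core is the interval $[\hat0,s_1\vee\cdots\vee s_r]$ with $s_1,\ldots,s_r$ the atoms of $\mathcal{L}$. -}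

module Defs where

open import Level using (Level; _⊔_)
open import Data.Nat using (ℕ; zero; suc; _<_)
open import Data.Fin using (Fin)
open import Data.Vec using (Vec; lookup)
open import Data.Maybe using (Maybe; just; nothing)
open import Data.List using (List)
open import Data.List.Relation.Unary.Any using (Any)
open import Data.Product using (Σ; ∃; _×_; proj₁)
open import Data.Sum using (_⊎_)
open import Data.Unit using (⊤)
open import Data.Empty using (⊥)
open import Relation.Nullary using (¬_)
open import Relation.Binary.PropositionalEquality using (_≡_)
open import Relation.Binary.Lattice.Bundles using (Lattice)

-- Order isomorphisms between (pre)ordered carriers.
-- f : A → B is an order isomorphism if it is order-preserving and
-- order-reflecting (x ≤ y ⇔ f x ≤ f y) and surjective up to ≈ on B.
-- (Injectivity up to ≈ follows from antisymmetry.)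

OrderIso : ∀ {a b ℓ₁ ℓ₂ ℓ₃} (A : Set a) (_≤A_ : A → A → Set ℓ₁)
           (B : Set b) (_≈B_ : B → B → Set ℓ₂) (_≤B_ : B → B → Set ℓ₃) →
           Set (a ⊔ b ⊔ ℓ₁ ⊔ ℓ₂ ⊔ ℓ₃)
OrderIso A _≤A_ B _≈B_ _≤B_ =
  Σ (A → B) λ f →
    (∀ x y → x ≤A y → f x ≤B f y) ×
    (∀ x y → f x ≤B f y → x ≤A y) ×
    (∀ b → ∃ λ x → f x ≈B b)

module _ {c ℓ₁ ℓ₂} (L : Lattice c ℓ₁ ℓ₂) where
  open Lattice L

  _<L_ : Carrier → Carrier → Set (ℓ₁ ⊔ ℓ₂)
  x <L y = x ≤ y × ¬ (x ≈ y)

  _⋖_ : Carrier → Carrier → Set (c ⊔ ℓ₁ ⊔ ℓ₂)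
  x ⋖ y = x <L y × (∀ z → x ≤ z → z ≤ y → (z ≈ x) ⊎ (z ≈ y))

  Filter : Carrier → Set (c ⊔ ℓ₂)
  Filter p = Σ Carrier (λ q → p ≤ q)

  _≤F_ : ∀ {p} → Filter p → Filter p → Set ℓ₂
  x ≤F y = proj₁ x ≤ proj₁ y

  -- finite type ℕ-graded with minimum 0̂ and rank function ρ.
  -- "every maximal chain is 0̂ = x₀ ⋖ x₁ ⋖ ⋯ with ρ(xᵢ) = i" is expressed
  -- (equivalently) by: ρ(0̂) = 0, ρ respects ≈, ρ is strictly monotone,
  -- and covers raise the rank by exactly one.
  record IsFiniteTypeGraded : Set (c ⊔ ℓ₁ ⊔ ℓ₂) where
    field
      𝟘         : Carrier
      𝟘-min     : ∀ x → 𝟘 ≤ x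
      ρ         : Carrier → ℕ
      ρ-𝟘       : ρ 𝟘 ≡ 0
      ρ-resp    : ∀ {x y} → x ≈ y → ρ x ≡ ρ y
      ρ-strict  : ∀ {x y} → x <L y → ρ x < ρ y
      ρ-cover   : ∀ {x y} → x ⋖ y → ρ y ≡ suc (ρ x)
      finite    : ∀ k → ∃ λ (xs : List Carrier) →
                    ∀ x → ρ x ≡ k → Any (x ≈_) xs

  record IsUpho : Set (c ⊔ ℓ₁ ⊔ ℓ₂) where
    field
      graded    : IsFiniteTypeGraded
      nontrivial : ∃ λ x → ∃ λ y → ¬ (x ≈ y)
      filterIso : ∀ p → OrderIso (Filter p) _≤F_ Carrier _≈_ _≤_
    open IsFiniteTypeGraded graded public

  module _ (U : IsUpho) where
    open IsUpho U

    IsAtom : Carrier → Set (c ⊔ ℓ₁ ⊔ ℓ₂)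
    IsAtom a = 𝟘 ⋖ a

    IsJoinOfAtoms : Carrier → Set (c ⊔ ℓ₁ ⊔ ℓ₂)
    IsJoinOfAtoms t = (∀ a → IsAtom a → a ≤ t) ×
                      (∀ u → (∀ a → IsAtom a → a ≤ u) → t ≤ u)

    -- the core [0̂, t] (every element is ≥ 0̂)
    Core : Carrier → Set (c ⊔ ℓ₂)
    Core t = Σ Carrier (λ x → x ≤ t)

    _≤C_ : ∀ {t} → Core t → Core t → Set ℓ₂
    x ≤C y = proj₁ x ≤ proj₁ y

-- A nonempty face is {x ∈ [-1,1]ⁿ : xᵢ = sᵢ for i with sᵢ ≠ free},
-- encoded by a sign vector s ∈ {-1, free, +1}ⁿ; the empty face is
-- `nothing`.

data Coord : Set where
  minus free plus : Coord

CubeFace : ℕ → Set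
CubeFace n = Maybe (Vec Coord n)

_⊆F_ : ∀ {n} → CubeFace n → CubeFace n → Set
nothing ⊆F _       = ⊤
just _  ⊆F nothing = ⊥
just s  ⊆F just s' = ∀ i → (lookup s' i ≡ free) ⊎ (lookup s i ≡ lookup s' i)

{-# OPTIONS --safe #-}
module Submission where

-- At the vertex v = (−,…,−), the faces between v and the 3-face Q = (∗,∗,∗,−,…,−) form a
-- Boolean lattice B₃.  Pull this interval back to the core [0̂, t] and push it along the
-- filter isomorphism at the preimage of v: it becomes an interval [0̂, u] of L isomorphic
-- to B₃.  Its three atoms are atoms of L, hence below t, and u is their join, so [0̂, u]
-- lies in the core.  The cube would then have a face with exactly 8 faces below it
-- (counting the empty face), but a face with k free coordinates has 3^k + 1 of them:
-- at most 4 if k ≤ 1 and at least 9 if k ≥ 2.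

open import Defs
open import Level using (_⊔_; 0ℓ)
open import Data.Bool as Bool using (Bool; true; false; f≤t; b≤b)
open import Data.Bool.Properties using (≤-antisym; ≤-minimum; ≤-maximum)
open import Data.Fin using (Fin; suc; _≟_)
open import Data.Fin.Patterns using (0F; 1F; 2F)
open import Data.Fin.Properties using (any?; 2↔Bool; *↔×; injective⇒≤)
open import Data.Maybe using (Maybe; just; nothing; maybe′)
open import Data.Maybe.Properties using (just-injective)
open import Data.Nat using (ℕ; _≤_; _+_; z≤n; s≤s)
open import Data.Nat.Properties using (≤⇒≤ᵇ)
open import Data.Product using (Σ; ∃; _×_; _,_; proj₁; proj₂)
open import Data.Product.Function.NonDependent.Propositional using (_×-↔_)
open import Data.Product.Relation.Binary.Pointwise.NonDependent using (Pointwise)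
open import Data.Sum using (_⊎_; inj₁; inj₂; [_,_])
open import Data.Unit using (tt)
open import Data.Vec using (Vec; []; _∷_; lookup; replicate; _[_]≔_)
open import Data.Vec.Properties using (lookup∘update; lookup∘update′)
open import Data.Vec.Relation.Binary.Pointwise.Extensional using (ext; Pointwise-≡⇒≡)
open import Function using (_∘_; _↔_; _↣_; mk↔ₛ′; mk↣; Inverse; Injection)
open import Function.Construct.Composition using (_↔-∘_; _↣-∘_)
open import Function.Construct.Identity using (↔-id)
open import Function.Construct.Symmetry using (↔-sym)
open import Function.Definitions using (Injective)
open import Function.Properties.Inverse using (↔⇒↣)
open import Relation.Binary.Bundles using (Poset)
open import Relation.Binary.Lattice.Bundles using (Lattice)
open import Relation.Binary.PropositionalEquality
  using (_≡_; _≢_; refl; sym; trans; cong; cong₂; subst; isEquivalence; module ≡-Reasoning)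
open import Relation.Nullary using (¬_; Dec; yes; no; ¬?; contradiction)
open import Relation.Nullary.Decidable using (_×-dec_)

private
  variable
    n k : ℕ

B₃ : Set
B₃ = Bool × Bool × Bool

_⊑_ : B₃ → B₃ → Set
_⊑_ = Pointwise Bool._≤_ (Pointwise Bool._≤_ Bool._≤_)

⊥₃ ⊤₃ e₁ e₂ e₃ : B₃
⊥₃ = false , false , false
⊤₃ = true , true , true
e₁ = true , false , false
e₂ = false , true , false
e₃ = false , false , true

data Atom₃ : B₃ → Set where
  atom₁ : Atom₃ e₁
  atom₂ : Atom₃ e₂
  atom₃ : Atom₃ e₃

private
  variable
    A B e : B₃

⊑-antisym : A ⊑ B → B ⊑ A → A ≡ B
⊑-antisym (p , q , r) (p′ , q′ , r′) =
  cong₂ _,_ (≤-antisym p p′) (cong₂ _,_ (≤-antisym q q′) (≤-antisym r r′))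

⊥₃-minimum : ∀ A → ⊥₃ ⊑ A
⊥₃-minimum (a , b , c) = ≤-minimum a , ≤-minimum b , ≤-minimum c

⊤₃-maximum : ∀ A → A ⊑ ⊤₃
⊤₃-maximum (a , b , c) = ≤-maximum a , ≤-maximum b , ≤-maximum c

⊑-atom : Atom₃ e → A ⊑ e → A ≡ ⊥₃ ⊎ A ≡ e
⊑-atom atom₁ (f≤t , b≤b , b≤b) = inj₁ refl
⊑-atom atom₁ (b≤b , b≤b , b≤b) = inj₂ refl
⊑-atom atom₂ (b≤b , f≤t , b≤b) = inj₁ refl
⊑-atom atom₂ (b≤b , b≤b , b≤b) = inj₂ refl
⊑-atom atom₃ (b≤b , b≤b , f≤t) = inj₁ refl
⊑-atom atom₃ (b≤b , b≤b , b≤b) = inj₂ refl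

atom-⋢-⊥₃ : Atom₃ e → ¬ e ⊑ ⊥₃
atom-⋢-⊥₃ atom₁ (() , _)
atom-⋢-⊥₃ atom₂ (_ , () , _)
atom-⋢-⊥₃ atom₃ (_ , _ , ())

atoms-⊑⇒⊤₃-⊑ : (∀ {e} → Atom₃ e → e ⊑ A) → ⊤₃ ⊑ A
atoms-⊑⇒⊤₃-⊑ h = proj₁ (h atom₁) , proj₁ (proj₂ (h atom₂)) , proj₂ (proj₂ (h atom₃))

Fin8↔B₃ : Fin 8 ↔ B₃
Fin8↔B₃ = (2↔Bool ×-↔ (2↔Bool ×-↔ 2↔Bool)) ↔-∘ ((↔-id _ ×-↔ *↔×) ↔-∘ *↔×)

record IsB₃Interval {c ℓ₁ ℓ₂} (P : Poset c ℓ₁ ℓ₂) (f : B₃ → Poset.Carrier P)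
                    : Set (c ⊔ ℓ₁ ⊔ ℓ₂) where
  open Poset P renaming (_≤_ to _≼_)
  field
    mono    : A ⊑ B → f A ≼ f B
    reflect : f A ≼ f B → A ⊑ B
    onto    : ∀ {z} → f ⊥₃ ≼ z → z ≼ f ⊤₃ → ∃ λ B → z ≈ f B

  injective : f A ≈ f B → A ≡ B
  injective fA≈fB = ⊑-antisym (reflect (reflexive fA≈fB)) (reflect (reflexive (Eq.sym fA≈fB)))

-- Core t and Filter p, with _≤C_ and _≤F_, are subposets of this form.
SubposetIso : ∀ {c ℓ₁ ℓ₂ c′ ℓ₁′ ℓ₂′ ℓ} (P : Poset c ℓ₁ ℓ₂) (Q : Poset c′ ℓ₁′ ℓ₂′) →
              (Poset.Carrier P → Set ℓ) → Set (c ⊔ ℓ₂ ⊔ c′ ⊔ ℓ₁′ ⊔ ℓ₂′ ⊔ ℓ)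
SubposetIso P Q S = OrderIso (Σ P.Carrier S) (λ x y → proj₁ x P.≤ proj₁ y) Q.Carrier Q._≈_ Q._≤_
  where
  module P = Poset P
  module Q = Poset Q

module SubposetIsoProperties
  {c ℓ₁ ℓ₂ c′ ℓ₁′ ℓ₂′ ℓ} (P : Poset c ℓ₁ ℓ₂) (Q : Poset c′ ℓ₁′ ℓ₂′)
  (S : Poset.Carrier P → Set ℓ) (h : SubposetIso P Q S) where

  private
    module P = Poset P
    module Q = Poset Q

  to : Σ P.Carrier S → Q.Carrier
  to = proj₁ h

  to-mono : ∀ {x y} → proj₁ x P.≤ proj₁ y → to x Q.≤ to y
  to-mono = proj₁ (proj₂ h) _ _

  to-reflect : ∀ {x y} → to x Q.≤ to y → proj₁ x P.≤ proj₁ y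
  to-reflect = proj₁ (proj₂ (proj₂ h)) _ _

  from : Q.Carrier → Σ P.Carrier S
  from q = proj₁ (proj₂ (proj₂ (proj₂ h)) q)

  to-from : ∀ q → to (from q) Q.≈ q
  to-from q = proj₂ (proj₂ (proj₂ (proj₂ h)) q)

  to-cong : ∀ {x y} → proj₁ x P.≈ proj₁ y → to x Q.≈ to y
  to-cong x≈y = Q.antisym (to-mono (P.reflexive x≈y)) (to-mono (P.reflexive (P.Eq.sym x≈y)))

  to-injective : ∀ {x y} → to x Q.≈ to y → proj₁ x P.≈ proj₁ y
  to-injective tx≈ty =
    P.antisym (to-reflect (Q.reflexive tx≈ty)) (to-reflect (Q.reflexive (Q.Eq.sym tx≈ty)))

  from-mono : ∀ {q r} → q Q.≤ r → proj₁ (from q) P.≤ proj₁ (from r)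
  from-mono q≤r =
    to-reflect (Q.≤-respˡ-≈ (Q.Eq.sym (to-from _)) (Q.≤-respʳ-≈ (Q.Eq.sym (to-from _)) q≤r))

  from-reflect : ∀ {q r} → proj₁ (from q) P.≤ proj₁ (from r) → q Q.≤ r
  from-reflect fq≤fr = Q.≤-respˡ-≈ (to-from _) (Q.≤-respʳ-≈ (to-from _) (to-mono fq≤fr))

  to-least : ∀ {w₀ q₀} → (∀ w → proj₁ w₀ P.≤ proj₁ w) → (∀ q → q₀ Q.≤ q) → to w₀ Q.≈ q₀
  to-least {w₀} {q₀} w₀-least q₀-least =
    Q.antisym (Q.≤-respʳ-≈ (to-from q₀) (to-mono (w₀-least (from q₀)))) (q₀-least (to w₀))

  push : ∀ {f} → IsB₃Interval P f → (f∈S : ∀ A → S (f A)) →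
         IsB₃Interval Q (λ A → to (f A , f∈S A))
  push {f} I f∈S = record
    { mono    = to-mono ∘ I.mono
    ; reflect = I.reflect ∘ to-reflect
    ; onto    = onto
    }
    where
    module I = IsB₃Interval I
    onto : ∀ {q} → to (f ⊥₃ , f∈S ⊥₃) Q.≤ q → q Q.≤ to (f ⊤₃ , f∈S ⊤₃) →
           ∃ λ B → q Q.≈ to (f B , f∈S B)
    onto {q} lo hi = proj₁ w∈I , Q.Eq.trans (Q.Eq.sym (to-from q)) (to-cong (proj₂ w∈I))
      where
      w∈I : ∃ λ B → proj₁ (from q) P.≈ f B
      w∈I = I.onto (to-reflect (Q.≤-respʳ-≈ (Q.Eq.sym (to-from q)) lo))
                   (to-reflect (Q.≤-respˡ-≈ (Q.Eq.sym (to-from q)) hi))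

  pull : (∀ {x y} → x P.≤ y → S y → S x) → ∀ {g} → IsB₃Interval Q g →
         IsB₃Interval P (λ A → proj₁ (from (g A)))
  pull S-down-closed {g} I = record
    { mono    = from-mono ∘ I.mono
    ; reflect = I.reflect ∘ from-reflect
    ; onto    = onto
    }
    where
    module I = IsB₃Interval I
    onto : ∀ {z} → proj₁ (from (g ⊥₃)) P.≤ z → z P.≤ proj₁ (from (g ⊤₃)) →
           ∃ λ B → z P.≈ proj₁ (from (g B))
    onto {z} lo hi = proj₁ tw∈I , to-injective (Q.Eq.trans (proj₂ tw∈I) (Q.Eq.sym (to-from _)))
      where
      w : Σ P.Carrier S
      w = z , S-down-closed hi (proj₂ (from (g ⊤₃)))
      tw∈I : ∃ λ B → to w Q.≈ g B
      tw∈I = I.onto (Q.≤-respˡ-≈ (to-from _) (to-mono lo)) (Q.≤-respʳ-≈ (to-from _) (to-mono hi))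

module _ {c ℓ₁ ℓ₂} (L : Lattice c ℓ₁ ℓ₂) where
  open Lattice L
    using (Carrier; _≈_; _∨_; poset; reflexive; x≤x∨y; y≤x∨y; ∨-least; module Eq)
    renaming (_≤_ to _≼_; trans to ≼-trans)
  open import Relation.Binary.Reasoning.PartialOrder poset

  ⊤₃-join-of-atoms : ∀ {f u} → IsB₃Interval poset f → (∀ {e} → Atom₃ e → f e ≼ u) → f ⊤₃ ≼ u
  ⊤₃-join-of-atoms {f} {u} I atoms≼u = begin
    f ⊤₃  ≤⟨ I.mono (atoms-⊑⇒⊤₃-⊑ (λ a → I.reflect (≼-trans (atom≼j a) (reflexive j≈fBⱼ)))) ⟩
    f Bⱼ  ≈⟨ Eq.sym j≈fBⱼ ⟩
    j     ≤⟨ ∨-least (atoms≼u atom₁) (∨-least (atoms≼u atom₂) (atoms≼u atom₃)) ⟩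
    u     ∎
    where
    module I = IsB₃Interval I
    j : Carrier
    j = f e₁ ∨ f e₂ ∨ f e₃
    atom≼j : ∀ {e} → Atom₃ e → f e ≼ j
    atom≼j atom₁ = x≤x∨y _ _
    atom≼j atom₂ = ≼-trans (x≤x∨y _ _) (y≤x∨y _ _)
    atom≼j atom₃ = ≼-trans (y≤x∨y _ _) (y≤x∨y _ _)
    j∈I : ∃ λ B → j ≈ f B
    j∈I = I.onto (≼-trans (I.mono (⊥₃-minimum e₁)) (atom≼j atom₁))
                 (∨-least (I.mono (⊤₃-maximum e₁))
                          (∨-least (I.mono (⊤₃-maximum e₂)) (I.mono (⊤₃-maximum e₃))))
    Bⱼ : B₃
    Bⱼ = proj₁ j∈I
    j≈fBⱼ : j ≈ f Bⱼ
    j≈fBⱼ = proj₂ j∈I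

  atom-covers : ∀ {f z} → IsB₃Interval poset f → z ≈ f ⊥₃ → Atom₃ e → _⋖_ L z (f e)
  atom-covers {e} {f} {z} I z≈f⊥ a = (z≼fe , z≉fe) , between
    where
    module I = IsB₃Interval I
    z≼fe : z ≼ f e
    z≼fe = ≼-trans (reflexive z≈f⊥) (I.mono (⊥₃-minimum e))
    z≉fe : ¬ z ≈ f e
    z≉fe z≈fe = atom-⋢-⊥₃ a (I.reflect (reflexive (Eq.trans (Eq.sym z≈fe) z≈f⊥)))
    between : ∀ w → z ≼ w → w ≼ f e → w ≈ z ⊎ w ≈ f e
    between w z≼w w≼fe
      with I.onto (≼-trans (reflexive (Eq.sym z≈f⊥)) z≼w) (≼-trans w≼fe (I.mono (⊤₃-maximum e)))
    ... | B , w≈fB with ⊑-atom a (I.reflect (≼-trans (reflexive (Eq.sym w≈fB)) w≼fe))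
    ...   | inj₁ refl = inj₁ (Eq.trans w≈fB (Eq.sym z≈f⊥))
    ...   | inj₂ refl = inj₂ w≈fB

⊆F-refl : (H : CubeFace n) → H ⊆F H
⊆F-refl nothing  = tt
⊆F-refl (just s) = λ _ → inj₂ refl

⊆F-trans : {H K M : CubeFace n} → H ⊆F K → K ⊆F M → H ⊆F M
⊆F-trans {H = nothing} _ _ = tt
⊆F-trans {H = just h} {just k} {just m} h⊆k k⊆m i with h⊆k i | k⊆m i
... | _            | inj₁ mᵢ-free = inj₁ mᵢ-free
... | inj₁ kᵢ-free | inj₂ kᵢ≡mᵢ   = inj₁ (trans (sym kᵢ≡mᵢ) kᵢ-free)
... | inj₂ hᵢ≡kᵢ   | inj₂ kᵢ≡mᵢ   = inj₂ (trans hᵢ≡kᵢ kᵢ≡mᵢ)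

⊆F-antisym : {H K : CubeFace n} → H ⊆F K → K ⊆F H → H ≡ K
⊆F-antisym {H = nothing} {nothing} _ _ = refl
⊆F-antisym {H = just h} {just k} h⊆k k⊆h =
  cong just (Pointwise-≡⇒≡ (ext λ i → coordinate (h⊆k i) (k⊆h i)))
  where
  coordinate : ∀ {a b : Coord} → b ≡ free ⊎ a ≡ b → a ≡ free ⊎ b ≡ a → a ≡ b
  coordinate _          (inj₂ b≡a) = sym b≡a
  coordinate (inj₂ a≡b) _          = a≡b
  coordinate (inj₁ b≡free) (inj₁ a≡free) = trans a≡free (sym b≡free)

cube-poset : ℕ → Poset 0ℓ 0ℓ 0ℓ
cube-poset n = record
  { Carrier        = CubeFace n
  ; _≈_            = _≡_
  ; _≤_            = _⊆F_
  ; isPartialOrder = record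
    { isPreorder = record
      { isEquivalence = isEquivalence
      ; reflexive     = λ { refl → ⊆F-refl _ }
      ; trans         = ⊆F-trans
      }
    ; antisym = ⊆F-antisym
    }
  }

minus-or-free : Bool → Coord
minus-or-free false = minus
minus-or-free true  = free

corner : ∀ m → B₃ → CubeFace (3 + m)
corner m (a , b , c) = just (minus-or-free a ∷ minus-or-free b ∷ minus-or-free c ∷ replicate m minus)

corner-interval : ∀ m → IsB₃Interval (cube-poset (3 + m)) (corner m)
corner-interval m = record { mono = mono ; reflect = reflect ; onto = onto }
  where
  coordinate-mono : ∀ {a b} → a Bool.≤ b → minus-or-free b ≡ free ⊎ minus-or-free a ≡ minus-or-free b
  coordinate-mono f≤t = inj₁ refl
  coordinate-mono b≤b = inj₂ refl

  coordinate-reflect : ∀ {a b} → minus-or-free b ≡ free ⊎ minus-or-free a ≡ minus-or-free b → a Bool.≤ b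
  coordinate-reflect {false} {b}     _        = ≤-minimum b
  coordinate-reflect {true}  {true}  _        = b≤b
  coordinate-reflect {true}  {false} (inj₁ ())
  coordinate-reflect {true}  {false} (inj₂ ())

  coordinate-onto : ∀ {c} → c ≡ free ⊎ minus ≡ c → ∃ λ b → minus-or-free b ≡ c
  coordinate-onto (inj₁ refl) = true , refl
  coordinate-onto (inj₂ refl) = false , refl

  all-minus : ∀ {k} (cs : Vec Coord k) →
              (∀ i → lookup (replicate k minus) i ≡ free ⊎ lookup cs i ≡ lookup (replicate k minus) i) →
              cs ≡ replicate k minus
  all-minus []       _  = refl
  all-minus (c ∷ cs) cs⊆ with cs⊆ 0F
  ... | inj₂ refl = cong (minus ∷_) (all-minus cs (cs⊆ ∘ suc))

  mono : A ⊑ B → corner m A ⊆F corner m B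
  mono (p , q , r) 0F                  = coordinate-mono p
  mono (p , q , r) 1F                  = coordinate-mono q
  mono (p , q , r) 2F                  = coordinate-mono r
  mono (p , q , r) (suc (suc (suc i))) = inj₂ refl

  reflect : corner m A ⊆F corner m B → A ⊑ B
  reflect A⊆B =
    coordinate-reflect (A⊆B 0F) , coordinate-reflect (A⊆B 1F) , coordinate-reflect (A⊆B 2F)

  onto : ∀ {H} → corner m ⊥₃ ⊆F H → H ⊆F corner m ⊤₃ → ∃ λ B → H ≡ corner m B
  onto {just (x ∷ y ∷ z ∷ cs)} lo hi
    with coordinate-onto (lo 0F) | coordinate-onto (lo 1F) | coordinate-onto (lo 2F)
       | all-minus cs (hi ∘ suc ∘ suc ∘ suc)
  ... | a , refl | b , refl | c , refl | refl = (a , b , c) , refl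

free? : (c : Coord) → Dec (c ≡ free)
free? minus = no λ ()
free? free  = yes refl
free? plus  = no λ ()

data FreeCoordinates (s : Vec Coord n) : Set where
  two-free         : ∀ {i j} → i ≢ j → lookup s i ≡ free → lookup s j ≡ free → FreeCoordinates s
  at-most-one-free : (o : Maybe (Fin n)) → (∀ {j} → lookup s j ≡ free → o ≡ just j) → FreeCoordinates s

free-coordinates : (s : Vec Coord n) → FreeCoordinates s
free-coordinates s with any? (λ i → free? (lookup s i))
... | no ¬some = at-most-one-free nothing (λ {j} sⱼ-free → contradiction (j , sⱼ-free) ¬some)
... | yes (i , sᵢ-free) with any? (λ j → ¬? (i ≟ j) ×-dec free? (lookup s j))
...   | yes (j , i≢j , sⱼ-free) = two-free i≢j sᵢ-free sⱼ-free
...   | no ¬other = at-most-one-free (just i) only-i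
  where
  only-i : ∀ {j} → lookup s j ≡ free → just i ≡ just j
  only-i {j} sⱼ-free with i ≟ j
  ... | yes i≡j = cong just i≡j
  ... | no i≢j  = contradiction (j , i≢j , sⱼ-free) ¬other

subface : Vec Coord n → Fin n → Fin n → Coord × Coord → CubeFace n
subface s i j (p , q) = just ((s [ i ]≔ p) [ j ]≔ q)

subface-⊆F : ∀ {s : Vec Coord n} {i j} → lookup s i ≡ free → lookup s j ≡ free →
             ∀ pq → subface s i j pq ⊆F just s
subface-⊆F {s = s} {i} {j} sᵢ-free sⱼ-free (p , q) k with k ≟ j | k ≟ i
... | yes refl | _        = inj₁ sⱼ-free
... | no _     | yes refl = inj₁ sᵢ-free
... | no k≢j   | no k≢i   =
  inj₂ (trans (lookup∘update′ k≢j (s [ i ]≔ p) q) (lookup∘update′ k≢i s p))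

subface-injective : ∀ {s : Vec Coord n} {i j} → i ≢ j → Injective _≡_ _≡_ (subface s i j)
subface-injective {s = s} {i} {j} i≢j {p , q} {p′ , q′} eq = cong₂ _,_ p≡p′ q≡q′
  where
  open ≡-Reasoning
  t≡t′ : (s [ i ]≔ p) [ j ]≔ q ≡ (s [ i ]≔ p′) [ j ]≔ q′
  t≡t′ = just-injective eq
  q≡q′ : q ≡ q′
  q≡q′ = begin
    q                                     ≡⟨ lookup∘update j (s [ i ]≔ p) q ⟨
    lookup ((s [ i ]≔ p) [ j ]≔ q) j     ≡⟨ cong (λ t → lookup t j) t≡t′ ⟩
    lookup ((s [ i ]≔ p′) [ j ]≔ q′) j   ≡⟨ lookup∘update j (s [ i ]≔ p′) q′ ⟩
    q′                                    ∎
  p≡p′ : p ≡ p′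
  p≡p′ = begin
    p                                     ≡⟨ lookup∘update i s p ⟨
    lookup (s [ i ]≔ p) i                 ≡⟨ lookup∘update′ i≢j (s [ i ]≔ p) q ⟨
    lookup ((s [ i ]≔ p) [ j ]≔ q) i     ≡⟨ cong (λ t → lookup t i) t≡t′ ⟩
    lookup ((s [ i ]≔ p′) [ j ]≔ q′) i   ≡⟨ lookup∘update′ i≢j (s [ i ]≔ p′) q′ ⟩
    lookup (s [ i ]≔ p′) i                ≡⟨ lookup∘update i s p′ ⟩
    p′                                    ∎

-- The value at coordinate o; minus is a dummy value when there is no such coordinate.
free-value : Maybe (Fin n) → CubeFace n → Maybe Coord
free-value o nothing  = nothing
free-value o (just h) = just (maybe′ (lookup h) minus o)

free-value-injective : ∀ {s : Vec Coord n} {o} → (∀ {j} → lookup s j ≡ free → o ≡ just j) →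
                       ∀ {H K} → H ⊆F just s → K ⊆F just s → free-value o H ≡ free-value o K → H ≡ K
free-value-injective only {nothing} {nothing} _ _ _ = refl
free-value-injective {o = o} only {just h} {just k} h⊆s k⊆s eq =
  cong just (Pointwise-≡⇒≡ (ext coordinate))
  where
  at-free : ∀ {c} → o ≡ just c → lookup h c ≡ lookup k c
  at-free refl = just-injective eq
  coordinate : ∀ c → lookup h c ≡ lookup k c
  coordinate c with h⊆s c | k⊆s c
  ... | inj₁ s-free | _           = at-free (only s-free)
  ... | inj₂ _      | inj₁ s-free = at-free (only s-free)
  ... | inj₂ h≡s    | inj₂ k≡s    = trans h≡s (sym k≡s)

Fin3↔Coord : Fin 3 ↔ Coord
Fin3↔Coord = mk↔ₛ′ (λ { 0F → minus ; 1F → free ; 2F → plus })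
                   (λ { minus → 0F ; free → 1F ; plus → 2F })
                   (λ { minus → refl ; free → refl ; plus → refl })
                   (λ { 0F → refl ; 1F → refl ; 2F → refl })

Fin4↔MaybeCoord : Fin 4 ↔ Maybe Coord
Fin4↔MaybeCoord = mk↔ₛ′ (λ { 0F → nothing ; (suc i) → just (Inverse.to Fin3↔Coord i) })
                        (λ { nothing → 0F ; (just c) → suc (Inverse.from Fin3↔Coord c) })
                        (λ { nothing → refl ; (just c) → cong just (Inverse.strictlyInverseˡ Fin3↔Coord c) })
                        (λ { 0F → refl ; (suc i) → cong suc (Inverse.strictlyInverseʳ Fin3↔Coord i) })

⊆F-∅ : {H : CubeFace n} → H ⊆F nothing → H ≡ nothing
⊆F-∅ {H = nothing} _ = refl

module _ {F : CubeFace n} {ψ : Fin k → CubeFace n} (ψ-injective : Injective _≡_ _≡_ ψ)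
         (ψ⊆F : ∀ i → ψ i ⊆F F) (ψ-onto : ∀ {H} → H ⊆F F → ∃ λ i → ψ i ≡ H) where

  at-most-four-subfaces : (code : CubeFace n → Maybe Coord) →
                          (∀ {H K} → H ⊆F F → K ⊆F F → code H ≡ code K → H ≡ K) → k ≤ 4
  at-most-four-subfaces code code-injective =
    injective⇒≤ (Injection.injective (↔⇒↣ (↔-sym Fin4↔MaybeCoord) ↣-∘ code∘ψ))
    where
    code∘ψ : Fin k ↣ Maybe Coord
    code∘ψ = mk↣ (ψ-injective ∘ code-injective (ψ⊆F _) (ψ⊆F _))

  at-least-nine-subfaces : (sub : Coord × Coord → CubeFace n) → Injective _≡_ _≡_ sub →
                           (∀ pq → sub pq ⊆F F) → 9 ≤ k
  at-least-nine-subfaces sub sub-injective sub⊆F =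
    injective⇒≤ (Injection.injective (index ↣-∘ ↔⇒↣ ((Fin3↔Coord ×-↔ Fin3↔Coord) ↔-∘ *↔×)))
    where
    open ≡-Reasoning
    index : (Coord × Coord) ↣ Fin k
    index = mk↣ λ {pq} {pq′} eq → sub-injective (begin
      sub pq                         ≡⟨ proj₂ (ψ-onto (sub⊆F pq)) ⟨
      ψ (proj₁ (ψ-onto (sub⊆F pq)))  ≡⟨ cong ψ eq ⟩
      ψ (proj₁ (ψ-onto (sub⊆F pq′))) ≡⟨ proj₂ (ψ-onto (sub⊆F pq′)) ⟩
      sub pq′                        ∎)

subface-count : ∀ {F : CubeFace n} {ψ : Fin k → CubeFace n} → Injective _≡_ _≡_ ψ →
                (∀ i → ψ i ⊆F F) → (∀ {H} → H ⊆F F → ∃ λ i → ψ i ≡ H) → k ≤ 4 ⊎ 9 ≤ k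
subface-count {F = nothing} ψ-injective ψ⊆F ψ-onto =
  inj₁ (at-most-four-subfaces ψ-injective ψ⊆F ψ-onto (λ _ → nothing)
         (λ H⊆∅ K⊆∅ _ → trans (⊆F-∅ H⊆∅) (sym (⊆F-∅ K⊆∅))))
subface-count {F = just s} ψ-injective ψ⊆F ψ-onto with free-coordinates s
... | two-free {i} {j} i≢j sᵢ-free sⱼ-free =
  inj₂ (at-least-nine-subfaces ψ-injective ψ⊆F ψ-onto (subface s i j)
         (subface-injective i≢j) (subface-⊆F {s = s} sᵢ-free sⱼ-free))
... | at-most-one-free o only =
  inj₁ (at-most-four-subfaces ψ-injective ψ⊆F ψ-onto (free-value o) (free-value-injective only))

no-B₃-interval-above-∅ : {ψ : B₃ → CubeFace n} → IsB₃Interval (cube-poset n) ψ → ψ ⊥₃ ≢ nothing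
no-B₃-interval-above-∅ {n} {ψ} I ψ⊥₃≡∅ =
  -- 8 ≰ 4 and 9 ≰ 8 hold by evaluating _≤ᵇ_.
  [ ≤⇒≤ᵇ , ≤⇒≤ᵇ ] (subface-count ψ′-injective (λ _ → I.mono (⊤₃-maximum _)) ψ′-onto)
  where
  module I = IsB₃Interval I
  ψ′ : Fin 8 → CubeFace n
  ψ′ = ψ ∘ Inverse.to Fin8↔B₃
  ψ′-injective : Injective _≡_ _≡_ ψ′
  ψ′-injective = Injection.injective (↔⇒↣ Fin8↔B₃) ∘ I.injective
  ψ′-onto : ∀ {H} → H ⊆F ψ ⊤₃ → ∃ λ i → ψ′ i ≡ H
  ψ′-onto H⊆ψ⊤ with I.onto (subst (_⊆F _) (sym ψ⊥₃≡∅) tt) H⊆ψ⊤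
  ... | B , H≡ψB =
    Inverse.from Fin8↔B₃ B , trans (cong ψ (Inverse.strictlyInverseˡ Fin8↔B₃ B)) (sym H≡ψB)

theorem5p13 : ∀ {c ℓ₁ ℓ₂} (n : ℕ) → 3 ≤ n →
              (L : Lattice c ℓ₁ ℓ₂) (U : IsUpho L) (t : Lattice.Carrier L) →
              IsJoinOfAtoms L U t →
              ¬ OrderIso (Core L U t) (_≤C_ L U) (CubeFace n) _≡_ _⊆F_
theorem5p13 .(3 + m) (s≤s (s≤s (s≤s (z≤n {m})))) L U t t-join G =
  no-B₃-interval-above-∅ ψ-interval ψ⊥₃≡∅
  where
  open Lattice L
    using (Carrier; _≈_; poset; reflexive; module Eq) renaming (_≤_ to _≼_; trans to ≼-trans)
  open IsUpho U using (𝟘; 𝟘-min; filterIso)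
  module CoreIso = SubposetIsoProperties poset (cube-poset (3 + m)) (_≼ t) G

  x : B₃ → Carrier
  x A = proj₁ (CoreIso.from (corner m A))
  x-interval : IsB₃Interval poset x
  x-interval = CoreIso.pull (λ z≼w w≼t → ≼-trans z≼w w≼t) (corner-interval m)

  x⊥₃≼x : ∀ A → x ⊥₃ ≼ x A
  x⊥₃≼x A = IsB₃Interval.mono x-interval (⊥₃-minimum A)
  module FilterIso = SubposetIsoProperties poset poset (x ⊥₃ ≼_) (filterIso (x ⊥₃))

  y : B₃ → Carrier
  y A = FilterIso.to (x A , x⊥₃≼x A)
  y-interval : IsB₃Interval poset y
  y-interval = FilterIso.push x-interval x⊥₃≼x
  y⊥₃≈𝟘 : y ⊥₃ ≈ 𝟘
  y⊥₃≈𝟘 = FilterIso.to-least proj₂ 𝟘-min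

  y≼t : ∀ A → y A ≼ t
  y≼t A = ≼-trans (IsB₃Interval.mono y-interval (⊤₃-maximum A))
                  (⊤₃-join-of-atoms L y-interval λ a →
                     proj₁ t-join _ (atom-covers L y-interval (Eq.sym y⊥₃≈𝟘) a))

  ψ-interval : IsB₃Interval (cube-poset (3 + m)) (λ A → CoreIso.to (y A , y≼t A))
  ψ-interval = CoreIso.push y-interval y≼t
  ψ⊥₃≡∅ : CoreIso.to (y ⊥₃ , y≼t ⊥₃) ≡ nothing
  ψ⊥₃≡∅ = CoreIso.to-least (λ w → ≼-trans (reflexive y⊥₃≈𝟘) (𝟘-min (proj₁ w))) (λ _ → tt)
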